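{- Every maximal non-PCG is a $2$-AND-PCG.
   Context: Graphs are finite, simple, undirected. All trees are unrooted with edges weighted by nonnegative reals; $d_T(u,v)$ is the sum of edge weights on the unique path between leaves $u,v$ of $T$. A graph $H=(V,E)$ is a PCG if there exist a tree $T$ with leaf set $V$ and an interval $I$ of nonnegative reals such that $\{u,v\}\in E$ iff $d_T(u,v)\in I$. A graph $G$ is a maximal non-PCG if $G$ is not a PCG but the graph obtained from $G$ by adding any single edge (between two non-adjacent vertices) is a PCG. A graph $G=(V,E)$ is a $k$-AND-PCG if there exist $k$ PCGs $G_1,\ldots,G_k$ on vertex set $V$ with $E=\bigcap_i E(G_i)$.
   Formalization: The edge weights of the tree T and the interval I in the definition of a PCG are taken over the nonnegative rationals instead of the nonnegative reals. -}

module Defs where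

open import Level using (0ℓ)
open import Data.Nat using (ℕ; zero; suc) renaming (_≤_ to _≤ℕ_)
open import Data.Fin using (Fin)
open import Data.Bool using (Bool; true; false; T)
open import Data.List using (List; []; _∷_; length; filterᵇ; allFin)
open import Data.List.Relation.Unary.Unique.Propositional using (Unique)
open import Data.Rational using (ℚ; 0ℚ; _+_; _≤_)
open import Data.Product using (Σ; ∃; _×_; _,_)
open import Data.Sum using (_⊎_)
open import Data.Empty using (⊥)
open import Relation.Binary.PropositionalEquality using (_≡_; _≢_)
open import Relation.Nullary using (¬_)
open import Function.Definitions using (Injective)
open import Function.Bundles using (_⇔_)

record Graph (n : ℕ) : Set where
  field
    adj    : Fin n → Fin n → Bool
    sym    : ∀ x y → adj x y ≡ adj y x
    irrefl : ∀ x → adj x x ≡ false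
open Graph public

data Walk {m : ℕ} (E : Fin m → Fin m → Bool) : Fin m → Fin m → Set where
  []   : ∀ {x} → Walk E x x
  step : ∀ {x y z} → T (E x y) → Walk E y z → Walk E x z

vertices : ∀ {m} {E : Fin m → Fin m → Bool} {x y} → Walk E x y → List (Fin m)
vertices {x = x} []         = x ∷ []
vertices {x = x} (step _ p) = x ∷ vertices p

edgeCount : ∀ {m} {E : Fin m → Fin m → Bool} {x y} → Walk E x y → ℕ
edgeCount []         = zero
edgeCount (step _ p) = suc (edgeCount p)

weight : ∀ {m} {E : Fin m → Fin m → Bool} (w : Fin m → Fin m → ℚ) {x y} → Walk E x y → ℚ
weight w []                   = 0ℚ
weight w (step {x} {y} _ p)   = w x y + weight w p

record WTree : Set where
  field
    size     : ℕ
    E        : Fin size → Fin size → Bool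
    E-sym    : ∀ x y → E x y ≡ E y x
    E-irrefl : ∀ x → E x x ≡ false
    w        : Fin size → Fin size → ℚ
    w-sym    : ∀ x y → w x y ≡ w y x
    w-nonneg : ∀ x y → 0ℚ ≤ w x y
    connected : ∀ x y → Walk E x y
    -- no cycle: no path x ~> y with distinct vertices and ≥ 2 edges closed by an edge y–x
    acyclic  : ∀ x y (p : Walk E x y) → Unique (vertices p) → 2 ≤ℕ edgeCount p → T (E y x) → ⊥
open WTree public

degree : (t : WTree) → Fin (size t) → ℕ
degree t x = length (filterᵇ (E t x) (allFin (size t)))

-- leaf: vertex of degree ≤ 1 (so a one-vertex tree is a leaf)
Leaf : (t : WTree) → Fin (size t) → Set
Leaf t x = degree t x ≤ℕ 1

-- An interval of nonnegative numbers: a convex subset of ℚ≥0 (= real interval ∩ ℚ).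
record Interval : Set₁ where
  field
    mem    : ℚ → Set
    nonneg : ∀ q → mem q → 0ℚ ≤ q
    convex : ∀ a b c → mem a → mem c → a ≤ b → b ≤ c → mem b
open Interval public

-- d_T(a,b) ∈ I, where d_T(a,b) is the weight of the (unique) path from a to b.
DistIn : (t : WTree) → Interval → Fin (size t) → Fin (size t) → Set
DistIn t I a b = Σ (Walk (E t) a b) λ p → Unique (vertices p) × mem I (weight (w t) p)

IsPCG : ∀ {n} → Graph n → Set₁
IsPCG {n} G =
  Σ WTree λ t →
  Σ (Fin n → Fin (size t)) λ ℓ →
    Injective _≡_ _≡_ ℓ ×
    (∀ x → Leaf t x ⇔ (∃ λ u → ℓ u ≡ x)) ×
    Σ Interval λ I →
      ∀ u v → u ≢ v → (T (adj G u v) ⇔ DistIn t I (ℓ u) (ℓ v))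

AddsEdge : ∀ {n} → Graph n → Fin n → Fin n → Graph n → Set
AddsEdge G u v H =
  ∀ x y → T (adj H x y) ⇔ (T (adj G x y) ⊎ ((x ≡ u × y ≡ v) ⊎ (x ≡ v × y ≡ u)))

MaximalNonPCG : ∀ {n} → Graph n → Set₁
MaximalNonPCG {n} G =
  ¬ IsPCG G ×
  (∀ u v → u ≢ v → adj G u v ≡ false → ∀ (H : Graph n) → AddsEdge G u v H → IsPCG H)

AndPCG : ℕ → ∀ {n} → Graph n → Set₁
AndPCG k {n} G =
  Σ (Fin k → Graph n) λ Gs →
    (∀ i → IsPCG (Gs i)) ×
    (∀ x y → T (adj G x y) ⇔ (∀ i → T (adj (Gs i) x y)))

{-# OPTIONS --safe #-}

-- If G has two different non-edges e and e′, it is the intersection of G + e and G + e′,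
-- which are PCGs by maximality. Otherwise G is the complement of a clique on a set S of at
-- most two vertices (the ends of its only non-edge, if any), and such a graph is a PCG,
-- contrary to assumption: take a star whose pendant edge to u has weight 1 if u ∈ S and 0
-- otherwise, and the interval [0, 1].
module Submission where

open import Defs hiding (sym)
open import Data.Nat using (ℕ; zero; suc; s≤s; z≤n) renaming (_≤_ to _≤ℕ_)
open import Data.Nat.Properties using (<⇒≱)
open import Data.Fin as Fin using (Fin; zero; suc; _≟_)
open import Data.Fin.Properties using (any?; suc-injective)
open import Data.Bool using (Bool; true; false; T; _∨_; if_then_else_) renaming (_≟_ to _≟ᵇ_)
open import Data.Bool.Properties using (T-∨; T-≡; ¬-not)
open import Data.List using (length; allFin; tabulate)
open import Data.List.Properties using (filter-all; filter-none; length-tabulate)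
open import Data.List.Membership.Propositional using (_∈_)
open import Data.List.Relation.Unary.All as All using ([]; _∷_)
open import Data.List.Relation.Unary.All.Properties using (tabulate⁺)
open import Data.List.Relation.Unary.AllPairs using ([]; _∷_)
open import Data.List.Relation.Unary.Any using (here)
open import Data.List.Relation.Unary.Unique.Propositional using (Unique)
open import Data.Rational using (ℚ; 0ℚ; 1ℚ; _+_; _≤_; _≤?_)
open import Data.Rational.Properties using (≤-refl; ≤-trans; +-identityʳ)
open import Data.Product using (∃; _×_; _,_; proj₁; proj₂)
open import Data.Empty using (⊥)
open import Data.Sum using (_⊎_; inj₁; inj₂; map₂)
open import Function using (_∘_; id)
open import Function.Bundles using (_⇔_; mk⇔; Equivalence)
import Function.Properties.Equivalence as ⇔
open import Relation.Binary.PropositionalEquality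
  using (_≡_; _≢_; refl; sym; trans; cong; cong₂; subst; module ≡-Reasoning)
open import Relation.Nullary using (¬_; Dec; yes; no; contradiction)
open import Relation.Nullary.Decidable
  using (⌊_⌋; T?; toWitness; fromWitness; from-yes; from-no; _×-dec_; _⊎-dec_; ¬?;
         isYes≗does; does-⇔; dec-false; decidable-stable)

open Equivalence using (to; from)

[0,_] : ℚ → Interval
[0, r ] = record
  { mem    = λ q → 0ℚ ≤ q × q ≤ r
  ; nonneg = λ _ → proj₁
  ; convex = λ _ _ _ (0≤a , _) (_ , c≤r) a≤b b≤c → ≤-trans 0≤a a≤b , ≤-trans b≤c c≤r
  }

infix 4 _∈[0,_]?
_∈[0,_]? : ∀ q r → Dec (mem [0, r ] q)
q ∈[0, r ]? = (0ℚ ≤? q) ×-dec (q ≤? r)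

start∈vertices : ∀ {m} {E : Fin m → Fin m → Bool} {x y} (p : Walk E x y) → x ∈ vertices p
start∈vertices []         = here refl
start∈vertices (step _ _) = here refl

module _ {n : ℕ} (allEq : (u v : Fin n) → u ≡ v) where

  edgeless : WTree
  edgeless = record
    { size      = n
    ; E         = λ _ _ → false
    ; E-sym     = λ _ _ → refl
    ; E-irrefl  = λ _ → refl
    ; w         = λ _ _ → 0ℚ
    ; w-sym     = λ _ _ → refl
    ; w-nonneg  = λ _ _ → ≤-refl
    ; connected = λ x y → subst (Walk _ x) (allEq x y) []
    ; acyclic   = λ _ _ _ _ _ ()
    }

  edgeless-isolated : ∀ x → degree edgeless x ≡ 0
  edgeless-isolated x = cong length (filter-none (T? ∘ λ _ → false) {allFin n} (tabulate⁺ λ _ → id))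

  subsingleton-isPCG : (G : Graph n) → IsPCG G
  subsingleton-isPCG G =
    edgeless , id , id ,
    (λ x → mk⇔ (λ _ → x , refl) (λ _ → subst (_≤ℕ 1) (sym (edgeless-isolated x)) z≤n)) ,
    [0, 1ℚ ] , λ u v u≢v → contradiction (allEq u v) u≢v

module _ {m : ℕ} where

  starE : Fin (suc m) → Fin (suc m) → Bool
  starE zero    (suc _) = true
  starE (suc _) zero    = true
  starE _       _       = false

  starE-sym : ∀ x y → starE x y ≡ starE y x
  starE-sym zero    zero    = refl
  starE-sym zero    (suc _) = refl
  starE-sym (suc _) zero    = refl
  starE-sym (suc _) (suc _) = refl

  starE-irrefl : ∀ x → starE x x ≡ false
  starE-irrefl zero    = refl
  starE-irrefl (suc _) = refl

  star-walk : ∀ x y → Walk starE x y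
  star-walk zero    zero    = []
  star-walk zero    (suc _) = step _ []
  star-walk (suc _) zero    = step _ []
  star-walk (suc _) (suc _) = step {y = zero} _ (step _ [])

  star-walk-unique : ∀ {x y} → x ≢ y → Unique (vertices (star-walk x y))
  star-walk-unique {zero}  {zero}  x≢x = contradiction refl x≢x
  star-walk-unique {zero}  {suc _} _   = ((λ ()) ∷ []) ∷ [] ∷ []
  star-walk-unique {suc _} {zero}  _   = ((λ ()) ∷ []) ∷ [] ∷ []
  star-walk-unique {suc _} {suc _} x≢y = ((λ ()) ∷ x≢y ∷ []) ∷ ((λ ()) ∷ []) ∷ [] ∷ []

  -- A simple walk passes through the centre at most once, so it has at most two edges,
  -- and a two-edge one joins two non-adjacent leaves.
  star-acyclic : ∀ x y (p : Walk starE x y) → Unique (vertices p) → 2 ≤ℕ edgeCount p → T (starE y x) → ⊥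
  star-acyclic _ _ [] _ () _
  star-acyclic _ _ (step _ []) _ (s≤s ()) _
  star-acyclic zero _ (step {y = zero} () _) _ _ _
  star-acyclic zero _ (step {y = suc _} _ (step {y = suc _} () _)) _ _ _
  star-acyclic zero _ (step {y = suc _} _ (step {y = zero} _ q)) ((_ ∷ 0∉q) ∷ _) _ _ =
    All.lookup 0∉q (start∈vertices q) refl
  star-acyclic (suc _) _ (step {y = suc _} () _) _ _ _
  star-acyclic (suc _) _ (step {y = zero} _ (step {y = zero} () _)) _ _ _
  star-acyclic (suc _) _ (step {y = zero} _ (step {y = suc _} _ [])) _ _ ()
  star-acyclic (suc _) _ (step {y = zero} _ (step {y = suc _} _ (step {y = suc _} () _))) _ _ _
  star-acyclic (suc _) _ (step {y = zero} _ (step {y = suc _} _ (step {y = zero} _ q))) (_ ∷ (_ ∷ 0∉q) ∷ _) _ _ =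
    All.lookup 0∉q (start∈vertices q) refl

  spoke : (Fin m → ℚ) → Fin (suc m) → Fin (suc m) → ℚ
  spoke g zero    (suc i) = g i
  spoke g (suc i) zero    = g i
  spoke g _       _       = 0ℚ

  spoke-sym : ∀ g x y → spoke g x y ≡ spoke g y x
  spoke-sym g zero    zero    = refl
  spoke-sym g zero    (suc _) = refl
  spoke-sym g (suc _) zero    = refl
  spoke-sym g (suc _) (suc _) = refl

  spoke-nonneg : ∀ {g} → (∀ i → 0ℚ ≤ g i) → ∀ x y → 0ℚ ≤ spoke g x y
  spoke-nonneg g≥0 zero    zero    = ≤-refl
  spoke-nonneg g≥0 zero    (suc i) = g≥0 i
  spoke-nonneg g≥0 (suc i) zero    = g≥0 i
  spoke-nonneg g≥0 (suc _) (suc _) = ≤-refl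

  star : (g : Fin m → ℚ) → (∀ i → 0ℚ ≤ g i) → WTree
  star g g≥0 = record
    { size      = suc m
    ; E         = starE
    ; E-sym     = starE-sym
    ; E-irrefl  = starE-irrefl
    ; w         = spoke g
    ; w-sym     = spoke-sym g
    ; w-nonneg  = spoke-nonneg g≥0
    ; connected = star-walk
    ; acyclic   = star-acyclic
    }

  module _ (g : Fin m → ℚ) (g≥0 : ∀ i → 0ℚ ≤ g i) where

    star-degree-centre : degree (star g g≥0) zero ≡ m
    star-degree-centre =
      trans (cong length (filter-all (T? ∘ starE zero) {tabulate Fin.suc} (tabulate⁺ λ _ → _))) (length-tabulate Fin.suc)

    star-degree-leaf : ∀ i → degree (star g g≥0) (suc i) ≡ 1
    star-degree-leaf i = cong (suc ∘ length) (filter-none (T? ∘ starE (suc i)) {tabulate Fin.suc} (tabulate⁺ λ _ ()))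

    star-leaf : 2 ≤ℕ m → ∀ x → Leaf (star g g≥0) x ⇔ ∃ λ i → suc i ≡ x
    star-leaf 2≤m zero    = mk⇔ (λ deg≤1 → contradiction (subst (_≤ℕ 1) star-degree-centre deg≤1) (<⇒≱ 2≤m))
                                (λ { (_ , ()) })
    star-leaf 2≤m (suc i) = mk⇔ (λ _ → i , refl) (λ _ → subst (_≤ℕ 1) (sym (star-degree-leaf i)) (s≤s z≤n))

    leaf-path-weight : ∀ {i j} (p : Walk starE (suc i) (suc j)) → Unique (vertices p) → i ≢ j →
                       weight (spoke g) p ≡ g i + g j
    leaf-path-weight [] _ i≢i = contradiction refl i≢i
    leaf-path-weight (step {y = suc _} () _) _ _
    leaf-path-weight (step {y = zero} _ (step {y = zero} () _)) _ _
    leaf-path-weight {i} {j} (step {y = zero} _ (step {y = suc _} _ [])) _ _ = cong (g i +_) (+-identityʳ (g j))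
    leaf-path-weight (step {y = zero} _ (step {y = suc _} _ (step {y = suc _} () _))) _ _
    leaf-path-weight (step {y = zero} _ (step {y = suc _} _ (step {y = zero} _ q))) (_ ∷ (_ ∷ 0∉q) ∷ _) _ =
      contradiction refl (All.lookup 0∉q (start∈vertices q))

    star-distance : ∀ I {i j} → i ≢ j → mem I (g i + g j) ⇔ DistIn (star g g≥0) I (suc i) (suc j)
    star-distance I {i} {j} i≢j = mk⇔
      (λ d → star-walk (suc i) (suc j) , path-unique ,
             subst (mem I) (sym (leaf-path-weight (star-walk (suc i) (suc j)) path-unique i≢j)) d)
      (λ (p , p-unique , d) → subst (mem I) (leaf-path-weight p p-unique i≢j) d)
      where
      path-unique : Unique (vertices (star-walk (suc i) (suc j)))
      path-unique = star-walk-unique (i≢j ∘ suc-injective)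

star-isPCG : ∀ {m} (G : Graph m) → 2 ≤ℕ m → (g : Fin m → ℚ) (g≥0 : ∀ i → 0ℚ ≤ g i) (I : Interval) →
             (∀ u v → u ≢ v → T (adj G u v) ⇔ mem I (g u + g v)) → IsPCG G
star-isPCG G 2≤m g g≥0 I adj⇔ =
  star g g≥0 , suc , suc-injective , star-leaf g g≥0 2≤m , I ,
  λ u v u≢v → ⇔.trans (adj⇔ u v u≢v) (star-distance g g≥0 I u≢v)

module _ {A : Set} {S : A → Set} (S? : ∀ x → Dec (S x)) where

  indicator : A → ℚ
  indicator x = if ⌊ S? x ⌋ then 1ℚ else 0ℚ

  indicator-nonneg : ∀ x → 0ℚ ≤ indicator x
  indicator-nonneg x with S? x
  ... | yes _ = from-yes (0ℚ ≤? 1ℚ)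
  ... | no  _ = ≤-refl

  ¬both⇔indicator-sum≤1 : ∀ u v → (¬ (S u × S v)) ⇔ mem [0, 1ℚ ] (indicator u + indicator v)
  ¬both⇔indicator-sum≤1 u v with S? u | S? v
  ... | yes su | yes sv = mk⇔ (λ ¬both → contradiction (su , sv) ¬both)
                              (λ (_ , 2≤1) → contradiction 2≤1 (from-no (1ℚ + 1ℚ ≤? 1ℚ)))
  ... | yes _  | no ¬sv = mk⇔ (λ _ → from-yes (1ℚ + 0ℚ ∈[0, 1ℚ ]?)) (λ _ → ¬sv ∘ proj₂)
  ... | no ¬su | yes _  = mk⇔ (λ _ → from-yes (0ℚ + 1ℚ ∈[0, 1ℚ ]?)) (λ _ → ¬su ∘ proj₁)
  ... | no ¬su | no _   = mk⇔ (λ _ → from-yes (0ℚ + 0ℚ ∈[0, 1ℚ ]?)) (λ _ → ¬su ∘ proj₁)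

complement-of-clique-isPCG : ∀ {n} (G : Graph n) {S : Fin n → Set} (S? : ∀ x → Dec (S x)) →
                             (∀ u v → u ≢ v → T (adj G u v) ⇔ (¬ (S u × S v))) → IsPCG G
-- On fewer than two vertices the centre of the star would be a leaf as well.
complement-of-clique-isPCG {zero}        G _  _    = subsingleton-isPCG (λ ()) G
complement-of-clique-isPCG {suc zero}    G _  _    = subsingleton-isPCG (λ { zero zero → refl }) G
complement-of-clique-isPCG {suc (suc _)} G S? adj⇔ =
  star-isPCG G (s≤s (s≤s z≤n)) (indicator S?) (indicator-nonneg S?) [0, 1ℚ ]
    λ u v u≢v → ⇔.trans (adj⇔ u v u≢v) (¬both⇔indicator-sum≤1 S? u v)

module _ {A : Set} where

  SamePair : A → A → A → A → Set
  SamePair a b x y = (x ≡ a × y ≡ b) ⊎ (x ≡ b × y ≡ a)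

  samePair-comm : ∀ {a b x y} → SamePair a b x y → SamePair a b y x
  samePair-comm (inj₁ (x≡a , y≡b)) = inj₂ (y≡b , x≡a)
  samePair-comm (inj₂ (x≡b , y≡a)) = inj₁ (y≡a , x≡b)

  samePair-unique : ∀ {a b c d x y} → SamePair a b x y → SamePair c d x y → SamePair a b c d
  samePair-unique (inj₁ (refl , refl)) (inj₁ (refl , refl)) = inj₁ (refl , refl)
  samePair-unique (inj₁ (refl , refl)) (inj₂ (refl , refl)) = inj₂ (refl , refl)
  samePair-unique (inj₂ (refl , refl)) (inj₁ (refl , refl)) = inj₂ (refl , refl)
  samePair-unique (inj₂ (refl , refl)) (inj₂ (refl , refl)) = inj₁ (refl , refl)

  samePair-distinct : ∀ {a b x} → a ≢ b → ¬ SamePair a b x x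
  samePair-distinct a≢b (inj₁ (refl , refl)) = a≢b refl
  samePair-distinct a≢b (inj₂ (refl , refl)) = a≢b refl

  samePair⇒bothIn : ∀ {a b u v} → SamePair a b u v → (u ≡ a ⊎ u ≡ b) × (v ≡ a ⊎ v ≡ b)
  samePair⇒bothIn (inj₁ (u≡a , v≡b)) = inj₁ u≡a , inj₂ v≡b
  samePair⇒bothIn (inj₂ (u≡b , v≡a)) = inj₂ u≡b , inj₁ v≡a

  bothIn⇒samePair : ∀ {a b u v} → u ≢ v → (u ≡ a ⊎ u ≡ b) × (v ≡ a ⊎ v ≡ b) → SamePair a b u v
  bothIn⇒samePair u≢v (inj₁ refl , inj₁ refl) = contradiction refl u≢v
  bothIn⇒samePair _   (inj₁ refl , inj₂ refl) = inj₁ (refl , refl)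
  bothIn⇒samePair _   (inj₂ refl , inj₁ refl) = inj₂ (refl , refl)
  bothIn⇒samePair u≢v (inj₂ refl , inj₂ refl) = contradiction refl u≢v

samePair? : ∀ {n} (a b x y : Fin n) → Dec (SamePair a b x y)
samePair? a b x y = (x ≟ a ×-dec y ≟ b) ⊎-dec (x ≟ b ×-dec y ≟ a)

module _ {n : ℕ} (G : Graph n) where

  NonEdge : Fin n → Fin n → Set
  NonEdge u v = u ≢ v × adj G u v ≡ false

  nonEdge? : ∀ u v → Dec (NonEdge u v)
  nonEdge? u v = ¬? (u ≟ v) ×-dec (adj G u v ≟ᵇ false)

  ¬nonEdge⇒adjacent : ∀ {u v} → u ≢ v → ¬ NonEdge u v → T (adj G u v)
  ¬nonEdge⇒adjacent u≢v ¬uv = from T-≡ (¬-not (λ uv → ¬uv (u≢v , uv)))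

  nonEdge-samePair : ∀ {a b u v} → NonEdge a b → SamePair a b u v → NonEdge u v
  nonEdge-samePair ab         (inj₁ (refl , refl)) = ab
  nonEdge-samePair (a≢b , ab) (inj₂ (refl , refl)) = a≢b ∘ sym , trans (Graph.sym G _ _) ab

  complete-isPCG : (∀ u v → ¬ NonEdge u v) → IsPCG G
  complete-isPCG noNonEdge = complement-of-clique-isPCG G {λ _ → ⊥} (λ _ → no id)
    λ u v u≢v → mk⇔ (λ _ → proj₁) (λ _ → ¬nonEdge⇒adjacent u≢v (noNonEdge u v))

  one-nonEdge-isPCG : ∀ {a b} → NonEdge a b → (∀ u v → NonEdge u v → SamePair a b u v) → IsPCG G
  one-nonEdge-isPCG {a} {b} ab onlyAB = complement-of-clique-isPCG G (λ x → x ≟ a ⊎-dec x ≟ b)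
    λ u v u≢v → mk⇔
      (λ uv bothIn → subst T (proj₂ (nonEdge-samePair ab (bothIn⇒samePair u≢v bothIn))) uv)
      (λ ¬bothIn → ¬nonEdge⇒adjacent u≢v (¬bothIn ∘ samePair⇒bothIn ∘ onlyAB u v))

  addEdge : ∀ {a b} → a ≢ b → Graph n
  addEdge {a} {b} a≢b = record
    { adj    = λ x y → adj G x y ∨ ⌊ samePair? a b x y ⌋
    ; sym    = λ x y → cong₂ _∨_ (Graph.sym G x y) (⌊samePair?⌋-comm x y)
    ; irrefl = λ x → cong₂ _∨_ (Graph.irrefl G x)
                       (trans (isYes≗does _) (dec-false (samePair? a b x x) (samePair-distinct a≢b)))
    }
    where
    open ≡-Reasoning
    ⌊samePair?⌋-comm : ∀ x y → ⌊ samePair? a b x y ⌋ ≡ ⌊ samePair? a b y x ⌋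
    ⌊samePair?⌋-comm x y = begin
      ⌊ samePair? a b x y ⌋        ≡⟨ isYes≗does _ ⟩
      Dec.does (samePair? a b x y) ≡⟨ does-⇔ (mk⇔ samePair-comm samePair-comm)
                                            (samePair? a b x y) (samePair? a b y x) ⟩
      Dec.does (samePair? a b y x) ≡⟨ isYes≗does _ ⟨
      ⌊ samePair? a b y x ⌋        ∎

  addEdge-adds : ∀ {a b} (a≢b : a ≢ b) → AddsEdge G a b (addEdge a≢b)
  addEdge-adds _ x y = mk⇔ (map₂ toWitness ∘ to T-∨) (from T-∨ ∘ map₂ fromWitness)

  addEdges-∩ : ∀ {a b c d H₁ H₂} → AddsEdge G a b H₁ → AddsEdge G c d H₂ → ¬ SamePair a b c d →
               ∀ x y → T (adj G x y) ⇔ (T (adj H₁ x y) × T (adj H₂ x y))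
  addEdges-∩ {H₁ = H₁} {H₂} adds₁ adds₂ ab≠cd x y =
    mk⇔ (λ xy → from (adds₁ x y) (inj₁ xy) , from (adds₂ x y) (inj₁ xy)) inBoth⇒adjacent
    where
    inBoth⇒adjacent : T (adj H₁ x y) × T (adj H₂ x y) → T (adj G x y)
    inBoth⇒adjacent (xy₁ , xy₂) with to (adds₁ x y) xy₁ | to (adds₂ x y) xy₂
    ... | inj₁ xy    | _          = xy
    ... | inj₂ _     | inj₁ xy    = xy
    ... | inj₂ xy=ab | inj₂ xy=cd = contradiction (samePair-unique xy=ab xy=cd) ab≠cd

  andPCG₂ : ∀ H₁ H₂ → IsPCG H₁ → IsPCG H₂ →
            (∀ x y → T (adj G x y) ⇔ (T (adj H₁ x y) × T (adj H₂ x y))) → AndPCG 2 G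
  andPCG₂ H₁ H₂ pcg₁ pcg₂ G=H₁∩H₂ = Hs , pcgs ,
    λ x y → ⇔.trans (G=H₁∩H₂ x y) (mk⇔ (λ (xy₁ , xy₂) → λ { zero → xy₁ ; (suc zero) → xy₂ })
                                       (λ xy → xy zero , xy (suc zero)))
    where
    Hs : Fin 2 → Graph n
    Hs zero       = H₁
    Hs (suc zero) = H₂
    pcgs : ∀ i → IsPCG (Hs i)
    pcgs zero       = pcg₁
    pcgs (suc zero) = pcg₂

  two-nonEdges⇒AndPCG₂ : MaximalNonPCG G → ∀ {a b c d} → NonEdge a b → NonEdge c d → ¬ SamePair a b c d →
                        AndPCG 2 G
  two-nonEdges⇒AndPCG₂ (_ , maximal) {a} {b} {c} {d} (a≢b , ab) (c≢d , cd) ab≠cd =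
    andPCG₂ (addEdge a≢b) (addEdge c≢d)
      (maximal a b a≢b ab (addEdge a≢b) (addEdge-adds a≢b))
      (maximal c d c≢d cd (addEdge c≢d) (addEdge-adds c≢d))
      (addEdges-∩ {H₁ = addEdge a≢b} {H₂ = addEdge c≢d} (addEdge-adds a≢b) (addEdge-adds c≢d) ab≠cd)

theorem11 : ∀ (n : ℕ) (G : Graph n) → MaximalNonPCG G → AndPCG 2 G
theorem11 _ G maximalG@(¬pcg , _) with any? (λ a → any? (nonEdge? G a))
... | no noNonEdge = contradiction (complete-isPCG G λ u v uv → noNonEdge (u , v , uv)) ¬pcg
... | yes (a , b , ab) with any? (λ c → any? λ d → nonEdge? G c d ×-dec ¬? (samePair? a b c d))
...   | yes (c , d , cd , ab≠cd) = two-nonEdges⇒AndPCG₂ G maximalG ab cd ab≠cd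
...   | no noOtherNonEdge = contradiction (one-nonEdge-isPCG G ab onlyAB) ¬pcg
  where
  onlyAB : ∀ u v → NonEdge G u v → SamePair a b u v
  onlyAB u v uv = decidable-stable (samePair? a b u v) λ ¬ab → noOtherNonEdge (u , v , uv , ¬ab)
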